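{- Let $\Gamma$ be a set of (possibly degenerate) tropical half-spaces in $\mathbb{P}^{n-1}_{\max}$, and let $\mathcal H=\mathcal H(a,I)$ be a (non-degenerate) half-space whose apex $a$ belongs to every half-space in $\Gamma$. Then $\bigcap_{\mathcal H'\in\Gamma}\mathcal H'\subset\mathcal H$ if and only if there exists a neighborhood $\mathscr N$ of $a$ in $\mathbb{P}^{n-1}_{\max}$ such that $\bigl(\bigcap_{\mathcal H'\in\Gamma}\mathcal H'\bigr)\cap\mathscr N\subset\mathcal H$.
   Context: Max-plus semiring $\mathbb{R}_{\max}=\mathbb{R}\cup\{ -\infty\}$ with $\oplus=\max$, $\otimes=+$; on $\mathbb{R}_{\max}^n$, componentwise maximum and $\lambda x=(\lambda+x_1,\dots,\lambda+x_n)$. $\mathbb{P}^{n-1}_{\max}=(\mathbb{R}_{\max}^n\setminus\{(-\infty,\dots,-\infty)\})/\mathbb{R}(1,\dots,1)$, with the topology induced by the extended Hilbert metric: $d_H(x,y)=\max_{y_i\neq-\infty}(x_i-y_i)-\min_{y_i\neq-\infty}(x_i-y_i)$ if $x$ and $y$ have the same set of finite coordinates, and $+\infty$ otherwise. A (possibly degenerate) half-space is $\{x\in\mathbb{P}^{n-1}_{\max}:\max_{i\in I}(x_i-\alpha_i)\ge\max_{j\in J}(x_j-\alpha_j)\}$ with $I,J\subset[n]$ disjoint non-empty and $\alpha_h\in\mathbb{R}$; it is non-degenerate when $I\cup J=[n]$, in which case it is written $\mathcal H(a,I)$ with apex $a=(\alpha_1,\dots,\alpha_n)\in\mathbb{P}^{n-1}$.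 -}

module Defs where

open import Level using (0ℓ)
open import Data.Fin using (Fin)
open import Data.Maybe using (Maybe; just; nothing)
open import Data.Product using (Σ; ∃; ∃-syntax; _×_; _,_)
open import Data.Bool using (Bool; true; false; not)
open import Data.Nat using (ℕ)
open import Data.Empty using (⊥)
open import Relation.Binary.PropositionalEquality using (_≡_; _≢_; refl)
open import Relation.Binary.Structures using (IsDecTotalOrder)
open import Algebra.Structures using (IsCommutativeRing)
open import Relation.Nullary using (¬_)
open import Function.Bundles using (_⇔_)

-- The real numbers, axiomatised as a (Dedekind-)complete ordered field
-- with propositional equality and a decidable total order
-- (all of which hold for ℝ classically).  The theorem is stated for an
-- arbitrary model of these axioms, i.e. for ℝ (unique up to iso).

record RealNumbers : Set₁ where
  infixl 6 _+_ _-_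
  infixl 7 _*_
  infix 4 _≤_ _<_
  field
    ℝ     : Set
    _+_   : ℝ → ℝ → ℝ
    _*_   : ℝ → ℝ → ℝ
    -_    : ℝ → ℝ
    0ℝ    : ℝ
    1ℝ    : ℝ
    _≤_   : ℝ → ℝ → Set
    isCommutativeRing : IsCommutativeRing _≡_ _+_ _*_ -_ 0ℝ 1ℝ
    0≢1   : 0ℝ ≢ 1ℝ
    inverse : ∀ x → x ≢ 0ℝ → ∃[ y ] (x * y ≡ 1ℝ)
    isDecTotalOrder : IsDecTotalOrder _≡_ _≤_
    +-monoˡ-≤ : ∀ {x y} z → x ≤ y → x + z ≤ y + z
    *-nonneg  : ∀ {x y} → 0ℝ ≤ x → 0ℝ ≤ y → 0ℝ ≤ x * y
    completeness : (P : ℝ → Set) → ∃[ x ] P x →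
                   ∃[ b ] (∀ x → P x → x ≤ b) →
                   ∃[ s ] ((∀ x → P x → x ≤ s) ×
                           (∀ b → (∀ x → P x → x ≤ b) → s ≤ b))

  _-_ : ℝ → ℝ → ℝ
  x - y = x + (- y)

  _<_ : ℝ → ℝ → Set
  x < y = x ≤ y × ¬ (x ≡ y)

module Tropical (R : RealNumbers) where
  open RealNumbers R

  -- ℝ_max = ℝ ∪ {-∞}; nothing stands for -∞.
  ℝmax : Set
  ℝmax = Maybe ℝ

  -- A point of ℝ_max^n different from (-∞,…,-∞).  Points of ℙ^{n-1}_max
  -- are represented by such vectors; every set below is invariant under
  -- x ↦ λx, so it is a set of points of ℙ^{n-1}_max.
  Point : ℕ → Set
  Point n = Σ (Fin n → ℝmax) (λ x → ∃[ i ] ∃[ r ] (x i ≡ just r))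

  vec : ∀ {n} → Point n → Fin n → ℝmax
  vec (x , _) = x

  Subset : ℕ → Set
  Subset n = Fin n → Bool

  _∈ₛ_ : ∀ {n} → Fin n → Subset n → Set
  i ∈ₛ S = S i ≡ true

  -- Data of a (possibly degenerate) half-space:
  --   { x : max_{i∈I}(x_i - α_i) ≥ max_{j∈J}(x_j - α_j) },
  -- I, J ⊆ [n] disjoint and non-empty, α ∈ ℝ^n.
  record HalfSpace (n : ℕ) : Set where
    constructor halfSpace
    field
      I J      : Subset n
      α        : Fin n → ℝ
      disjoint : ∀ i → i ∈ₛ I → i ∈ₛ J → ⊥
      I≠∅      : ∃[ i ] (i ∈ₛ I)
      J≠∅      : ∃[ j ] (j ∈ₛ J)

  -- max_{i∈I}(x_i - α_i) ≥ max_{j∈J}(x_j - α_j) in ℝ_max, written out: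
  -- every finite term on the right is ≤ some finite term on the left
  -- (terms with x_k = -∞ equal -∞; max over all -∞ terms is -∞).
  _∈H_ : ∀ {n} → Point n → HalfSpace n → Set
  x ∈H h = ∀ j → j ∈ₛ J → ∀ xj → vec x j ≡ just xj →
           ∃[ i ] (i ∈ₛ I × ∃[ xi ] (vec x i ≡ just xi × xj - α j ≤ xi - α i))
    where open HalfSpace h

  private
    not-disj : ∀ (b : Bool) → b ≡ true → not b ≡ true → ⊥
    not-disj true refl ()
    not-compl : ∀ (b : Bool) → b ≡ false → not b ≡ true
    not-compl false refl = refl

  -- The non-degenerate half-space 𝓗(a, I) with apex a ∈ ℝ^n:
  -- J = [n] ∖ I, α = a;  I and its complement must be non-empty.
  nonDeg : ∀ {n} → (a : Fin n → ℝ) → (I : Subset n) →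
           ∃[ i ] (i ∈ₛ I) → ∃[ j ] (I j ≡ false) → HalfSpace n
  nonDeg a I ne (j , e) =
    halfSpace I (λ k → not (I k)) a (λ i → not-disj (I i)) ne
              (j , not-compl (I j) e)

  finitePoint : ∀ {n} → (a : Fin n → ℝ) → Fin n → Point n
  finitePoint a i = (λ k → just (a k)) , (i , a i , refl)

  -- d_H(x, y) < ε for the extended Hilbert metric, written out:
  -- x and y have the same finite coordinates, and
  -- max_{finite k}(x_k - y_k) - min_{finite k}(x_k - y_k) < ε,
  -- i.e. (x_k - y_k) - (x_l - y_l) < ε for all finite k, l.
  -- (If the supports differ, d_H = +∞ and this never holds.)
  dH<_ : ∀ {n} → ℝ → Point n → Point n → Set
  (dH< ε) x y =
    (∀ k → (∃[ r ] (vec x k ≡ just r)) ⇔ (∃[ r ] (vec y k ≡ just r))) ×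
    (∀ k l xk yk xl yl → vec x k ≡ just xk → vec y k ≡ just yk →
       vec x l ≡ just xl → vec y l ≡ just yl →
       (xk - yk) - (xl - yl) < ε)

  IsOpen : ∀ {n} → (Point n → Set) → Set
  IsOpen U = ∀ x → U x → ∃[ ε ] (0ℝ < ε × (∀ y → (dH< ε) y x → U y))

  IsNeighbourhood : ∀ {n} → (Point n → Set) → Point n → Set₁
  IsNeighbourhood N p =
    Σ (Point _ → Set) λ U → IsOpen U × U p × (∀ x → U x → N x)

-- A tropical half-space is closed under x ↦ λ ⊙ x and under ⊕, so a ⊕ ((d − r) ⊙ x) ∈ ⋂Γ
-- whenever a, x ∈ ⋂Γ.  If x ∈ ⋂Γ lies outside 𝓗(a, I), the maximum r of x_l − a_l is not
-- reached on I, and this point has offsets max(0, d + (x_l − a_l) − r) ∈ [0, d]: equal to d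
-- where x attains r, strictly below d on I.  Hence it lies within Hilbert distance d of a,
-- in ⋂Γ, and outside 𝓗, contradicting the local inclusion once d is small.

module Submission where

open import Defs
open import Data.Empty using (⊥-elim)
open import Data.Product using (Σ; ∃; ∃-syntax; _×_; _,_; proj₁; proj₂)
open import Data.Sum using (_⊎_; inj₁; inj₂)
open import Relation.Nullary using (¬_; yes; no)
open import Function using (_∘_)
open import Relation.Binary.PropositionalEquality
  using (_≡_; _≢_; refl; sym; trans; cong; cong₂; subst; subst₂; module ≡-Reasoning)
open import Data.Bool using (true; false; not)
open import Data.Unit using (⊤; tt)
open import Relation.Binary.Bundles using (TotalOrder)
open import Relation.Binary.Structures using (IsDecTotalOrder)
open import Algebra.Structures using (IsCommutativeRing)
open import Algebra.Bundles using (CommutativeRing)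
open import Data.Maybe as Maybe using (just; nothing)
open import Data.Maybe.Properties using (just-injective)
open import Function.Bundles using (mk⇔)
open import Data.Nat as ℕ using ()
open import Data.Fin using (Fin; zero; suc)
open import Data.List using (allFin)
import Data.List.Relation.Unary.All as All
open import Data.List.Membership.Propositional.Properties using (∈-allFin)

∃⊎∀ : ∀ {n} {P Q : Fin n → Set} → (∀ i → P i ⊎ Q i) → ∃ P ⊎ (∀ i → Q i)
∃⊎∀ {ℕ.zero}  P⊎Q = inj₂ λ ()
∃⊎∀ {ℕ.suc n} P⊎Q with P⊎Q zero | ∃⊎∀ (P⊎Q ∘ suc)
... | inj₁ P₀ | _              = inj₁ (zero , P₀)
... | inj₂ _  | inj₁ (i , Pᵢ)  = inj₁ (suc i , Pᵢ)
... | inj₂ Q₀ | inj₂ Q₊        = inj₂ λ { zero → Q₀ ; (suc i) → Q₊ i }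

module OrderedFieldProperties (R : RealNumbers) where
  open RealNumbers R
  open IsCommutativeRing isCommutativeRing
    using (+-comm; +-assoc; +-identityˡ; +-identityʳ; -‿inverseʳ;
           *-assoc; *-identityˡ; *-identityʳ; distribˡ; distribʳ)
  open IsDecTotalOrder isDecTotalOrder public
    using (antisym; total; _≤?_; isTotalOrder) renaming (trans to ≤-trans)

  commutativeRing : CommutativeRing _ _
  commutativeRing = record { isCommutativeRing = isCommutativeRing }

  open CommutativeRing commutativeRing using (ring; +-abelianGroup)
  open import Algebra.Properties.Ring ring
    using (-‿distribˡ-*; -‿distribʳ-*; x+x≈x⇒x≈0)
  open import Algebra.Properties.AbelianGroup +-abelianGroup
    using (⁻¹-involutive; identityʳ-unique; x∙y⁻¹≈ε⇒x≈y)

  +-monoʳ-≤ : ∀ z {x y} → x ≤ y → z + x ≤ z + y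
  +-monoʳ-≤ z {x} {y} x≤y = subst₂ _≤_ (+-comm x z) (+-comm y z) (+-monoˡ-≤ z x≤y)

  ≤-<-trans : ∀ {x y z} → x ≤ y → y < z → x < z
  ≤-<-trans x≤y (y≤z , y≢z) = ≤-trans x≤y y≤z , λ { refl → y≢z (antisym y≤z x≤y) }

  <-≤-trans : ∀ {x y z} → x < y → y ≤ z → x < z
  <-≤-trans (x≤y , x≢y) y≤z = ≤-trans x≤y y≤z , λ { refl → x≢y (antisym x≤y y≤z) }

  <-irrefl : ∀ {x} → ¬ x < x
  <-irrefl (_ , x≢x) = x≢x refl

  x≤y⇒x-y≤0 : ∀ {x y} → x ≤ y → x - y ≤ 0ℝ
  x≤y⇒x-y≤0 {y = y} x≤y = subst (_ ≤_) (-‿inverseʳ y) (+-monoˡ-≤ (- y) x≤y)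

  x<y⇒x-y<0 : ∀ {x y} → x < y → x - y < 0ℝ
  x<y⇒x-y<0 {x} {y} (x≤y , x≢y) = x≤y⇒x-y≤0 x≤y , λ x-y≡0 → x≢y (x∙y⁻¹≈ε⇒x≈y x y x-y≡0)

  x≤0⇒y+x≤y : ∀ {x} y → x ≤ 0ℝ → y + x ≤ y
  x≤0⇒y+x≤y {x} y x≤0 = subst (y + x ≤_) (+-identityʳ y) (+-monoʳ-≤ y x≤0)

  x<0⇒y+x<y : ∀ {x} y → x < 0ℝ → y + x < y
  x<0⇒y+x<y {x} y (x≤0 , x≢0) = x≤0⇒y+x≤y y x≤0 , λ y+x≡y → x≢0 (identityʳ-unique y x y+x≡y)

  0≤x⇒y≤y+x : ∀ {x} y → 0ℝ ≤ x → y ≤ y + x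
  0≤x⇒y≤y+x {x} y 0≤x = subst (_≤ y + x) (+-identityʳ y) (+-monoʳ-≤ y 0≤x)

  0≤x⇒-x≤0 : ∀ {x} → 0ℝ ≤ x → - x ≤ 0ℝ
  0≤x⇒-x≤0 {x} 0≤x = subst₂ _≤_ (+-identityˡ (- x)) (-‿inverseʳ x) (+-monoˡ-≤ (- x) 0≤x)

  x≤0⇒0≤-x : ∀ {x} → x ≤ 0ℝ → 0ℝ ≤ - x
  x≤0⇒0≤-x {x} x≤0 = subst₂ _≤_ (-‿inverseʳ x) (+-identityˡ (- x)) (+-monoˡ-≤ (- x) x≤0)

  0≤y⇒x-y≤x : ∀ x {y} → 0ℝ ≤ y → x - y ≤ x
  0≤y⇒x-y≤x x 0≤y = x≤0⇒y+x≤y x (0≤x⇒-x≤0 0≤y)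

  -x*-x≡x*x : ∀ x → - x * - x ≡ x * x
  -x*-x≡x*x x = begin
    - x * - x     ≡⟨ -‿distribˡ-* x (- x) ⟨
    - (x * - x)   ≡⟨ cong -_ (-‿distribʳ-* x x) ⟨
    - (- (x * x)) ≡⟨ ⁻¹-involutive (x * x) ⟩
    x * x         ∎
    where open ≡-Reasoning

  0≤x*x : ∀ x → 0ℝ ≤ x * x
  0≤x*x x with total 0ℝ x
  ... | inj₁ 0≤x = *-nonneg 0≤x 0≤x
  ... | inj₂ x≤0 = subst (0ℝ ≤_) (-x*-x≡x*x x) (*-nonneg (x≤0⇒0≤-x x≤0) (x≤0⇒0≤-x x≤0))

  0<1 : 0ℝ < 1ℝ
  0<1 = subst (0ℝ ≤_) (*-identityˡ 1ℝ) (0≤x*x 1ℝ) , 0≢1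

  x+x≡y⇒0<x<y : ∀ {x y} → 0ℝ ≤ x → x + x ≡ y → 0ℝ < y → 0ℝ < x × x < y
  x+x≡y⇒0<x<y {x} 0≤x refl (_ , 0≢x+x) =
    (0≤x , 0≢x+x ∘ 0≡x+x ∘ sym) ,
    (0≤x⇒y≤y+x x 0≤x , λ x≡x+x → 0≢x+x (0≡x+x (x+x≈x⇒x≈0 x (sym x≡x+x))))
    where
    0≡x+x : x ≡ 0ℝ → 0ℝ ≡ x + x
    0≡x+x refl = sym (+-identityʳ 0ℝ)

  ≤∨> : ∀ x y → x ≤ y ⊎ y < x
  ≤∨> x y with x ≤? y | total x y
  ... | yes x≤y | _       = inj₁ x≤y
  ... | no  x≰y | inj₁ x≤y = ⊥-elim (x≰y x≤y)
  ... | no  x≰y | inj₂ y≤x = inj₂ (y≤x , λ { refl → x≰y y≤x })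

  x≤y⇒0≤y-x : ∀ {x y} → x ≤ y → 0ℝ ≤ y - x
  x≤y⇒0≤y-x {x} x≤y = subst (_≤ _) (-‿inverseʳ x) (+-monoˡ-≤ (- x) x≤y)

  x-y+z-w≡x+[z-w-y] : ∀ x y z w → (x - y) + z - w ≡ x + ((z - w) - y)
  x-y+z-w≡x+[z-w-y] x y z w = begin
    (x - y) + z - w    ≡⟨ +-assoc (x - y) z (- w) ⟩
    (x - y) + (z - w)  ≡⟨ +-assoc x (- y) (z - w) ⟩
    x + (- y + (z - w)) ≡⟨ cong (x +_) (+-comm (- y) (z - w)) ⟩
    x + ((z - w) - y)  ∎
    where open ≡-Reasoning

  ∃-between-0-and : ∀ {ε} → 0ℝ < ε → ∃[ δ ] (0ℝ < δ × δ < ε)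
  ∃-between-0-and {ε} 0<ε@(0≤ε , _) = ε * ½ , x+x≡y⇒0<x<y (*-nonneg 0≤ε 0≤½) ε/2+ε/2≡ε 0<ε
    where
    open ≡-Reasoning
    2ℝ = 1ℝ + 1ℝ
    0≤2 : 0ℝ ≤ 2ℝ
    0≤2 = ≤-trans (proj₁ 0<1) (0≤x⇒y≤y+x 1ℝ (proj₁ 0<1))
    2≢0 : 2ℝ ≢ 0ℝ
    2≢0 2≡0 = 0≢1 (antisym (proj₁ 0<1) (subst (1ℝ ≤_) 2≡0 (0≤x⇒y≤y+x 1ℝ (proj₁ 0<1))))
    ½ = proj₁ (inverse 2ℝ 2≢0)
    2*½≡1 : 2ℝ * ½ ≡ 1ℝ
    2*½≡1 = proj₂ (inverse 2ℝ 2≢0)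
    0≤½ : 0ℝ ≤ ½
    0≤½ = subst (0ℝ ≤_) 2*[½*½]≡½ (*-nonneg 0≤2 (0≤x*x ½))
      where
      2*[½*½]≡½ : 2ℝ * (½ * ½) ≡ ½
      2*[½*½]≡½ = begin
        2ℝ * (½ * ½) ≡⟨ *-assoc 2ℝ ½ ½ ⟨
        (2ℝ * ½) * ½ ≡⟨ cong (_* ½) 2*½≡1 ⟩
        1ℝ * ½       ≡⟨ *-identityˡ ½ ⟩
        ½            ∎
    ε/2+ε/2≡ε : ε * ½ + ε * ½ ≡ ε
    ε/2+ε/2≡ε = begin
      ε * ½ + ε * ½   ≡⟨ distribˡ ε ½ ½ ⟨
      ε * (½ + ½)     ≡⟨ cong (ε *_) (cong₂ _+_ (*-identityˡ ½) (*-identityˡ ½)) ⟨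
      ε * (1ℝ * ½ + 1ℝ * ½) ≡⟨ cong (ε *_) (distribʳ ½ 1ℝ 1ℝ) ⟨
      ε * (2ℝ * ½)    ≡⟨ cong (ε *_) 2*½≡1 ⟩
      ε * 1ℝ          ≡⟨ *-identityʳ ε ⟩
      ε               ∎

module MaxPlusProperties (R : RealNumbers) where
  open RealNumbers R
  open Tropical R
  open OrderedFieldProperties R
  open IsCommutativeRing isCommutativeRing using (+-assoc; +-identityʳ; -‿inverseʳ)
  open import Relation.Binary.Construct.Add.Infimum.NonStrict _≤_
    using (_≤₋_; [_]; [≤]-injective; ≤₋-isTotalOrder-≡)

  ℝmax-totalOrder : TotalOrder _ _ _
  ℝmax-totalOrder = record { isTotalOrder = ≤₋-isTotalOrder-≡ isTotalOrder }

  open import Algebra.Construct.NaturalChoice.Max ℝmax-totalOrder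
    using (_⊔_; x≤x⊔y; x≤y⊔x; ⊔-sel)
  open import Data.List.Extrema ℝmax-totalOrder using (argmax; f[⊥]≤f[argmax]; f[xs]≤f[argmax])

  ≤₋-just : ∀ {m m′ p} → m ≤₋ m′ → m ≡ just p → ∃[ q ] (m′ ≡ just q × p ≤ q)
  ≤₋-just [ p≤q ] refl = _ , refl , p≤q

  map-just : ∀ {f : ℝ → ℝ} {m q} → Maybe.map f m ≡ just q → ∃[ s ] (m ≡ just s × f s ≡ q)
  map-just {m = just s} refl = s , refl , refl

  infixr 6 _⊕_
  infixr 7 _⊙_

  _⊕_ : ∀ {n} → Point n → Point n → Point n
  (x , i , r , xᵢ≡r) ⊕ y = (λ k → x k ⊔ vec y k) , i , proj₁ w , proj₁ (proj₂ w)
    where w = ≤₋-just (x≤x⊔y (x i) (vec y i)) xᵢ≡r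

  _⊙_ : ∀ {n} → ℝ → Point n → Point n
  μ ⊙ (x , i , r , xᵢ≡r) = (λ k → Maybe.map (μ +_) (x k)) , i , μ + r , cong (Maybe.map (μ +_)) xᵢ≡r

  -- x ∈H h unfolds to MaxIAtLeast h x (x_j − α_j) for every finite coordinate j ∈ J.
  MaxIAtLeast : ∀ {n} → HalfSpace n → Point n → ℝ → Set
  MaxIAtLeast h x t = ∃[ i ] (i ∈ₛ I × ∃[ w ] (vec x i ≡ just w × t ≤ w - α i))
    where open HalfSpace h

  MaxIAtLeast-mono : ∀ {n} (h : HalfSpace n) {x y : Point n} → (∀ i → vec x i ≤₋ vec y i) →
                     ∀ {t} → MaxIAtLeast h x t → MaxIAtLeast h y t
  MaxIAtLeast-mono h x≤y (i , i∈I , w , xᵢ≡w , t≤w-αᵢ) with ≤₋-just (x≤y i) xᵢ≡w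
  ... | w′ , yᵢ≡w′ , w≤w′ = i , i∈I , w′ , yᵢ≡w′ , ≤-trans t≤w-αᵢ (+-monoˡ-≤ _ w≤w′)

  MaxIAtLeast-antitone : ∀ {n} (h : HalfSpace n) (x : Point n) {t t′} → t ≤ t′ →
                         MaxIAtLeast h x t′ → MaxIAtLeast h x t
  MaxIAtLeast-antitone h x t≤t′ (i , i∈I , w , xᵢ≡w , t′≤w-αᵢ) = i , i∈I , w , xᵢ≡w , ≤-trans t≤t′ t′≤w-αᵢ

  ∈H-⊕ : ∀ {n} (x y : Point n) (h : HalfSpace n) → x ∈H h → y ∈H h → (x ⊕ y) ∈H h
  ∈H-⊕ x y h x∈h y∈h j j∈J t [x⊕y]ⱼ≡t with ⊔-sel (vec x j) (vec y j)
  ... | inj₁ xⱼ≡ = MaxIAtLeast-mono h {x} {x ⊕ y} (λ i → x≤x⊔y (vec x i) (vec y i))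
                     (x∈h j j∈J t (trans (sym xⱼ≡) [x⊕y]ⱼ≡t))
  ... | inj₂ yⱼ≡ = MaxIAtLeast-mono h {y} {x ⊕ y} (λ i → x≤y⊔x (vec x i) (vec y i))
                     (y∈h j j∈J t (trans (sym yⱼ≡) [x⊕y]ⱼ≡t))

  ∈H-⊙ : ∀ {n} μ (x : Point n) (h : HalfSpace n) → x ∈H h → (μ ⊙ x) ∈H h
  ∈H-⊙ μ x h x∈h j j∈J t [μx]ⱼ≡t with map-just {μ +_} [μx]ⱼ≡t
  ... | s , xⱼ≡s , refl with x∈h j j∈J s xⱼ≡s
  ... | i , i∈I , w , xᵢ≡w , s-αⱼ≤w-αᵢ =
    i , i∈I , μ + w , cong (Maybe.map (μ +_)) xᵢ≡w ,
    subst₂ _≤_ (sym (+-assoc μ s _)) (sym (+-assoc μ w _)) (+-monoʳ-≤ μ s-αⱼ≤w-αᵢ)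
    where open HalfSpace h using (α)

  _∈⋂_ : ∀ {n} → Point n → (HalfSpace n → Set) → Set
  x ∈⋂ Γ = ∀ h → Γ h → x ∈H h

  ∈⋂-⊕⊙ : ∀ {n} {Γ : HalfSpace n → Set} {x y : Point n} μ → x ∈⋂ Γ → y ∈⋂ Γ → (x ⊕ (μ ⊙ y)) ∈⋂ Γ
  ∈⋂-⊕⊙ {x = x} {y} μ x∈⋂Γ y∈⋂Γ h h∈Γ = ∈H-⊕ x (μ ⊙ y) h (x∈⋂Γ h h∈Γ) (∈H-⊙ μ y h (y∈⋂Γ h h∈Γ))

  offset : ∀ {n} → Point n → (Fin n → ℝ) → Fin n → ℝmax
  offset x c l = Maybe.map (_- c l) (vec x l)

  IsMaxOffset : ∀ {n} → Point n → (Fin n → ℝ) → Fin n → ℝ → Set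
  IsMaxOffset x c k v = vec x k ≡ just v × (∀ l s → vec x l ≡ just s → s - c l ≤ v - c k)

  -- argmax starts from a finite coordinate, so the maximiser is finite too.
  maxOffset : ∀ {n} (x : Point n) (c : Fin n → ℝ) → ∃[ k ] ∃[ v ] IsMaxOffset x c k v
  maxOffset {n} x@(_ , i₀ , r₀ , xᵢ₀≡r₀) c
    with ≤₋-just (f[⊥]≤f[argmax] {f = offset x c} i₀ (allFin n)) (cong (Maybe.map _) xᵢ₀≡r₀)
  ... | _ , offsetₖ≡q , _ with map-just offsetₖ≡q
  ... | v , xₖ≡v , _ = argmax (offset x c) i₀ (allFin n) , v , xₖ≡v , λ l s xₗ≡s →
    [≤]-injective (subst₂ _≤₋_ (cong (Maybe.map _) xₗ≡s) (cong (Maybe.map _) xₖ≡v)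
      (All.lookup (f[xs]≤f[argmax] i₀ (allFin n)) (∈-allFin l)))

  module Perturbation {n} (a : Fin n → ℝ) (i₀ : Fin n) (x : Point n) (d r : ℝ) where

    perturbed : Point n
    perturbed = finitePoint a i₀ ⊕ ((d - r) ⊙ x)

    apex≤perturbed : ∀ l → just (a l) ≤₋ vec perturbed l
    apex≤perturbed l = x≤x⊔y (just (a l)) (vec ((d - r) ⊙ x) l)

    perturbed-finite : ∀ l → ∃[ t ] (vec perturbed l ≡ just t)
    perturbed-finite l with ≤₋-just (apex≤perturbed l) refl
    ... | t , yₗ≡t , _ = t , yₗ≡t

    0≤offset : ∀ l {t} → vec perturbed l ≡ just t → 0ℝ ≤ t - a l
    0≤offset l yₗ≡t = x≤y⇒0≤y-x ([≤]-injective (subst (just (a l) ≤₋_) yₗ≡t (apex≤perturbed l)))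

    offset-cases : ∀ l {t} → vec perturbed l ≡ just t →
                   t - a l ≡ 0ℝ ⊎ ∃[ s ] (vec x l ≡ just s × t - a l ≡ d + ((s - a l) - r))
    offset-cases l yₗ≡t with ⊔-sel (just (a l)) (vec ((d - r) ⊙ x) l)
    ... | inj₁ yₗ≡aₗ = inj₁ (trans (cong (_- a l) (just-injective (trans (sym yₗ≡t) yₗ≡aₗ))) (-‿inverseʳ (a l)))
    ... | inj₂ yₗ≡[d-r]xₗ with map-just {(d - r) +_} (trans (sym yₗ≡[d-r]xₗ) yₗ≡t)
    ... | s , xₗ≡s , refl = inj₂ (s , xₗ≡s , x-y+z-w≡x+[z-w-y] d r s (a l))

    offset≤ : 0ℝ ≤ d → ∀ l → (∀ s → vec x l ≡ just s → s - a l ≤ r) →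
              ∀ {t} → vec perturbed l ≡ just t → t - a l ≤ d
    offset≤ 0≤d l below yₗ≡t with offset-cases l yₗ≡t
    ... | inj₁ eq = subst (_≤ d) (sym eq) 0≤d
    ... | inj₂ (s , xₗ≡s , eq) = subst (_≤ d) (sym eq) (x≤0⇒y+x≤y d (x≤y⇒x-y≤0 (below s xₗ≡s)))

    offset< : 0ℝ < d → ∀ l → (∀ s → vec x l ≡ just s → s - a l < r) →
              ∀ {t} → vec perturbed l ≡ just t → t - a l < d
    offset< 0<d l below yₗ≡t with offset-cases l yₗ≡t
    ... | inj₁ eq = subst (_< d) (sym eq) 0<d
    ... | inj₂ (s , xₗ≡s , eq) = subst (_< d) (sym eq) (x<0⇒y+x<y d (x<y⇒x-y<0 (below s xₗ≡s)))

    d≤offset : ∀ {k v} → vec x k ≡ just v → r ≡ v - a k → ∀ {t} → vec perturbed k ≡ just t → d ≤ t - a k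
    d≤offset {k} {v} xₖ≡v r≡ yₖ≡t
      with ≤₋-just (x≤y⊔x (just (a k)) (vec ((d - r) ⊙ x) k)) (cong (Maybe.map ((d - r) +_)) xₖ≡v)
    ... | t , yₖ≡t′ , [d-r]+v≤t = subst₂ _≤_ d-r+v-aₖ≡d (cong (_- a k) (just-injective (trans (sym yₖ≡t′) yₖ≡t)))
                                    (+-monoˡ-≤ (- a k) [d-r]+v≤t)
      where
      d-r+v-aₖ≡d : (d - r) + v - a k ≡ d
      d-r+v-aₖ≡d = begin
        (d - r) + v - a k ≡⟨ x-y+z-w≡x+[z-w-y] d r v (a k) ⟩
        d + ((v - a k) - r) ≡⟨ cong (λ r′ → d + (r′ - r)) r≡ ⟨
        d + (r - r) ≡⟨ cong (d +_) (-‿inverseʳ r) ⟩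
        d + 0ℝ ≡⟨ +-identityʳ d ⟩
        d ∎
        where open ≡-Reasoning

    perturbed-near : ∀ {ε} → 0ℝ ≤ d → d < ε → (∀ l s → vec x l ≡ just s → s - a l ≤ r) →
                     (dH< ε) perturbed (finitePoint a i₀)
    perturbed-near 0≤d d<ε below =
      (λ l → mk⇔ (λ _ → a l , refl) (λ _ → perturbed-finite l)) ,
      λ { l m tₗ .(a l) tₘ .(a m) yₗ≡tₗ refl yₘ≡tₘ refl →
          ≤-<-trans (0≤y⇒x-y≤x _ (0≤offset m yₘ≡tₘ)) (≤-<-trans (offset≤ 0≤d l (below l) yₗ≡tₗ) d<ε) }

  whole-isNeighbourhood : ∀ {n} (p : Point n) → IsNeighbourhood (λ _ → ⊤) p
  whole-isNeighbourhood p = (λ _ → ⊤) , (λ _ _ → 1ℝ , 0<1 , λ _ _ → tt) , tt , λ _ _ → tt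

  module NonDegenerate {n} (a : Fin n → ℝ) (I : Subset n)
                       (I≠∅ : ∃[ i ] (i ∈ₛ I)) (Iᶜ≠∅ : ∃[ j ] (I j ≡ false)) where

    apex : Point n
    apex = finitePoint a (proj₁ I≠∅)

    𝓗 : HalfSpace n
    𝓗 = nonDeg a I I≠∅ Iᶜ≠∅

    strictMaxOutsideI⇒∉𝓗 : ∀ {y : Point n} {k tₖ} → not (I k) ≡ true → vec y k ≡ just tₖ →
         (∀ i → i ∈ₛ I → ∀ t → vec y i ≡ just t → t - a i < tₖ - a k) → ¬ y ∈H 𝓗
    strictMaxOutsideI⇒∉𝓗 k∉I yₖ≡tₖ belowᴵ y∈𝓗 with y∈𝓗 _ k∉I _ yₖ≡tₖ
    ... | i , i∈I , t , yᵢ≡t , tₖ-aₖ≤t-aᵢ = <-irrefl (<-≤-trans (belowᴵ i i∈I t yᵢ≡t) tₖ-aₖ≤t-aᵢ)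

    reaches-or-below : ∀ (x : Point n) r i →
                       (i ∈ₛ I × ∃[ w ] (vec x i ≡ just w × r ≤ w - a i)) ⊎
                       (i ∈ₛ I → ∀ w → vec x i ≡ just w → w - a i < r)
    reaches-or-below x r i with I i | vec x i
    ... | false | _      = inj₂ λ ()
    ... | true  | nothing = inj₂ λ _ _ ()
    ... | true  | just w with ≤∨> r (w - a i)
    ... | inj₁ r≤w-aᵢ = inj₁ (refl , w , refl , r≤w-aᵢ)
    ... | inj₂ w-aᵢ<r = inj₂ λ { _ _ refl → w-aᵢ<r }

    escapes-near-apex : ∀ {Γ} (x : Point n) {k v} → apex ∈⋂ Γ → x ∈⋂ Γ → IsMaxOffset x a k v →
                        (∀ i → i ∈ₛ I → ∀ w → vec x i ≡ just w → w - a i < v - a k) →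
                        ∀ {ε} → 0ℝ < ε → ∃[ y ] (y ∈⋂ Γ × (dH< ε) y apex × ¬ y ∈H 𝓗)
    escapes-near-apex {Γ} x {k} {v} apex∈⋂Γ x∈⋂Γ (xₖ≡v , maximal) belowᴵ 0<ε
      with ∃-between-0-and 0<ε
    ... | d , 0<d , d<ε =
      perturbed ,
      ∈⋂-⊕⊙ {Γ = Γ} {apex} {x} (d - r) apex∈⋂Γ x∈⋂Γ ,
      perturbed-near (proj₁ 0<d) d<ε maximal ,
      strictMaxOutsideI⇒∉𝓗 {perturbed} k∉I yₖ≡tₖ λ i i∈I t yᵢ≡t →
        <-≤-trans (offset< 0<d i (belowᴵ i i∈I) yᵢ≡t) (d≤offset xₖ≡v refl yₖ≡tₖ)
      where
      r = v - a k
      open Perturbation a (proj₁ I≠∅) x d r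

      k∉I : not (I k) ≡ true
      k∉I with I k in Iₖ≡
      ... | true  = ⊥-elim (<-irrefl (belowᴵ k Iₖ≡ v xₖ≡v))
      ... | false = refl

      tₖ = proj₁ (perturbed-finite k)
      yₖ≡tₖ = proj₂ (perturbed-finite k)

    local⇒global : ∀ {Γ} → apex ∈⋂ Γ →
                   (Σ (Point n → Set) λ N → IsNeighbourhood N apex × (∀ x → x ∈⋂ Γ → N x → x ∈H 𝓗)) →
                   ∀ x → x ∈⋂ Γ → x ∈H 𝓗
    local⇒global {Γ} apex∈⋂Γ (N , (U , U-open , apex∈U , U⊆N) , N∩⋂Γ⊆𝓗) x x∈⋂Γ j j∉I xⱼ xⱼ≡
      with maxOffset x a
    ... | k , v , max@(_ , maximal) with ∃⊎∀ (reaches-or-below x (v - a k))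
    ... | inj₁ reached = MaxIAtLeast-antitone 𝓗 x (maximal j xⱼ xⱼ≡) reached
    ... | inj₂ belowᴵ with U-open apex apex∈U
    ... | ε , 0<ε , ball with escapes-near-apex {Γ} x apex∈⋂Γ x∈⋂Γ max belowᴵ 0<ε
    ... | y , y∈⋂Γ , y-near , y∉𝓗 = ⊥-elim (y∉𝓗 (N∩⋂Γ⊆𝓗 y y∈⋂Γ (U⊆N y (ball y y-near))))

mainTheorem12 : (R : RealNumbers) →
    let open RealNumbers R
        open Tropical R
    in ∀ {n} (Γ : HalfSpace n → Set) (a : Fin n → ℝ) (I : Subset n)
         (I≠∅ : ∃[ i ] (i ∈ₛ I)) (Iᶜ≠∅ : ∃[ j ] (I j ≡ false)) →
       let apex = finitePoint a (proj₁ I≠∅)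
           𝓗 = nonDeg a I I≠∅ Iᶜ≠∅
           ⋂Γ = λ (x : Point n) → ∀ h → Γ h → x ∈H h
       in (∀ h → Γ h → apex ∈H h) →
          (((∀ x → ⋂Γ x → x ∈H 𝓗) →
              Σ (Point n → Set) λ N →
                IsNeighbourhood N apex × (∀ x → ⋂Γ x → N x → x ∈H 𝓗)) ×
           ((Σ (Point n → Set) λ N →
                IsNeighbourhood N apex × (∀ x → ⋂Γ x → N x → x ∈H 𝓗)) →
              ∀ x → ⋂Γ x → x ∈H 𝓗))
mainTheorem12 R Γ a I I≠∅ Iᶜ≠∅ apex∈⋂Γ =
  (λ ⋂Γ⊆𝓗 → (λ _ → ⊤) , whole-isNeighbourhood apex , λ x x∈⋂Γ _ → ⋂Γ⊆𝓗 x x∈⋂Γ) ,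
  local⇒global apex∈⋂Γ
  where
  open MaxPlusProperties R
  open NonDegenerate a I I≠∅ Iᶜ≠∅
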